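{- Let $n\ge1$ and let $\alpha_0 \ge \alpha_1 \ge \ldots \ge \alpha_{n-1}$ be ordinals such that for each $i < n - 1$ every remainder of $\alpha_i$ is order-isomorphic to $\alpha_i$ (no such requirement is made for $\alpha_{n-1}$). Then every order embedding $f$ of the ordered sum $\sum_{i<n}\alpha_i$ into itself is of the form $f=\sum_{i<n} f_i$ for some order embeddings $f_i:\alpha_i\hookrightarrow\alpha_i$, $i<n$; that is, $$\mathrm{Emb}\Big(\sum_{i < n} \alpha_i, \sum_{i < n} \alpha_i\Big) = \sum_{i < n} \mathrm{Emb}(\alpha_i, \alpha_i).$$
   Context: $\mathrm{Emb}(X,Y)$ is the set of order embeddings $X\hookrightarrow Y$. The ordered sum $\sum_{i<n}\alpha_i$ is the set $\bigcup_{i<n}\alpha_i\times\{i\}$ with $(\xi,i)<(\eta,j)$ iff $i<j$, or $i=j$ and $\xi<\eta$. For maps $f_i:\alpha_i\to\alpha_i$, $\sum_{i<n}f_i$ is the map $(\xi,i)\mapsto(f_i(\xi),i)$, and $\sum_{i<n}\mathrm{Emb}(\alpha_i,\alpha_i)=\{\sum_{i<n}f_i : f_i\in\mathrm{Emb}(\alpha_i,\alpha_i)\}$. A remainder of an ordinal $\alpha$ is a set $\alpha\setminus\xi$ for some $\xi<\alpha$. -}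

module Defs where

open import Level using (0ℓ)
open import Data.Nat using (ℕ; suc)
open import Data.Fin using (Fin; toℕ)
import Data.Fin as F
open import Data.Product using (Σ; ∃; _×_; _,_; proj₁; proj₂)
open import Data.Sum using (_⊎_)
open import Function.Bundles using (_⇔_)
open import Relation.Binary.Core using (Rel)
open import Relation.Binary.Structures using (IsStrictTotalOrder)
open import Relation.Binary.PropositionalEquality using (_≡_)
open import Induction.WellFounded using (WellFounded)

record Ordinal : Set₁ where
  field
    Carrier            : Set
    _<_                : Rel Carrier 0ℓ
    isStrictTotalOrder : IsStrictTotalOrder _≡_ _<_
    wellFounded        : WellFounded _<_

  _≤_ : Rel Carrier 0ℓ
  x ≤ y = x ≡ y ⊎ x < y

open Ordinal public using (Carrier)

IsOrderEmbedding : {A B : Set} → Rel A 0ℓ → Rel B 0ℓ → (A → B) → Set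
IsOrderEmbedding {A} _<A_ _<B_ f = ∀ (x y : A) → (x <A y) ⇔ (f x <B f y)

Emb : Ordinal → Ordinal → Set
Emb α β = Σ (Carrier α → Carrier β) (IsOrderEmbedding (Ordinal._<_ α) (Ordinal._<_ β))

-- Ordinal comparison: α ≤ β iff α is order-isomorphic to an initial segment of β,
-- i.e. there is an order embedding of α into β whose image is downward closed.
_≤ₒ_ : Ordinal → Ordinal → Set
α ≤ₒ β = Σ (Emb α β) λ e →
  ∀ (x : Carrier α) (y : Carrier β) → Ordinal._<_ β y (proj₁ e x) →
    ∃ λ (x′ : Carrier α) → proj₁ e x′ ≡ y

-- The remainder α ∖ ξ = { η | ξ ≤ η } is order-isomorphic to α:
-- there is an order embedding h of α into α whose image is exactly α ∖ ξ.
RemainderIsoToSelf : (α : Ordinal) → Carrier α → Set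
RemainderIsoToSelf α ξ = Σ (Carrier α → Carrier α) λ h →
  IsOrderEmbedding (Ordinal._<_ α) (Ordinal._<_ α) h
  × (∀ x → Ordinal._≤_ α ξ (h x))
  × (∀ η → Ordinal._≤_ α ξ η → ∃ λ x → h x ≡ η)

SumCarrier : {n : ℕ} → (Fin n → Ordinal) → Set
SumCarrier {n} α = Σ (Fin n) λ i → Carrier (α i)

data SumLt {n : ℕ} (α : Fin n → Ordinal) : Rel (SumCarrier α) 0ℓ where
  diff : ∀ {i j x y} → i F.< j → SumLt α (i , x) (j , y)
  same : ∀ {i x y} → Ordinal._<_ (α i) x y → SumLt α (i , x) (i , y)

sumMap : {n : ℕ} (α : Fin n → Ordinal) →
         ((i : Fin n) → Carrier (α i) → Carrier (α i)) →
         SumCarrier α → SumCarrier α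
sumMap α fs (i , x) = (i , fs i x)

-- An order embedding f of a well-ordered set into itself never moves a point
-- down, so f maps each block α_m into blocks ≥ m. Suppose, going from the top
-- block downwards, that every block above m is mapped into itself, and that
-- f (m , w₀) lies in a later block. Since α_m ≅ α_m ∖ w₀, all of α_m is then
-- squeezed by f into block m+1 strictly below one point f (m+1 , u); composing
-- with an embedding α_{m+1} ↪ α_m yields an order-preserving self-map of α_m
-- that moves a point down, which is impossible.
module Submission where

open import Defs
open import Level using (0ℓ)
open import Data.Nat using (ℕ; suc; s≤s; _<_; _≤_)
import Data.Nat.Properties as ℕ
open import Data.Fin using (Fin; toℕ; fromℕ<)
import Data.Fin as F
import Data.Fin.Properties as FP
open import Data.Fin.Induction using (<-wellFounded; >-wellFounded)
open import Data.Product using (Σ; ∃; _×_; _,_; proj₁; proj₂)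
open import Data.Sum using (inj₁; inj₂)
open import Data.Empty using (⊥-elim)
open import Relation.Nullary using (¬_)
open import Relation.Binary.Core using (Rel)
open import Relation.Binary.PropositionalEquality
open import Function.Bundles using (Equivalence; mk⇔)
open import Induction.WellFounded
  using (Acc; acc; WellFounded; module Subrelation; module Lexicographic)

monotone⇒¬φx≺x : ∀ {A : Set} {_≺_ : Rel A 0ℓ} → WellFounded _≺_ →
                 (φ : A → A) → (∀ {x y} → x ≺ y → φ x ≺ φ y) → ∀ x → ¬ (φ x ≺ x)
monotone⇒¬φx≺x {_≺_ = _≺_} wf φ mono x = go x (wf x)
  where
  go : ∀ x → Acc _≺_ x → ¬ (φ x ≺ x)
  go x (acc rec) φx≺x = go (φ x) (rec φx≺x) (mono φx≺x)

proj₁≡⇒Σ≡ : ∀ {A : Set} {B : A → Set} (p : Σ A B) {a : A} →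
            proj₁ p ≡ a → ∃ λ (b : B a) → p ≡ (a , b)
proj₁≡⇒Σ≡ (a , b) refl = b , refl

descend : ∀ {n} (P : Fin n → Set) → (∀ {i j} → toℕ j ≡ suc (toℕ i) → P j → P i) →
          ∀ {i j} → i F.≤ j → P j → P i
descend P step {i} {j} i≤j Pj = go i (>-wellFounded i) i≤j
  where
  go : ∀ i → Acc F._>_ i → i F.≤ j → P i
  go i (acc rec) i≤j with ℕ.m≤n⇒m<n∨m≡n i≤j
  ... | inj₂ i≡j = subst P (sym (FP.toℕ-injective i≡j)) Pj
  ... | inj₁ i<j = step i′≡1+i (go i′ (rec i<i′) i′≤j)
    where
    1+i<n : suc (toℕ i) < _
    1+i<n = ℕ.≤-trans (s≤s i<j) (FP.toℕ<n j)
    i′ = fromℕ< 1+i<n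
    i′≡1+i : toℕ i′ ≡ suc (toℕ i)
    i′≡1+i = FP.toℕ-fromℕ< 1+i<n
    i<i′ : i F.< i′
    i<i′ = subst (toℕ i <_) (sym i′≡1+i) ℕ.≤-refl
    i′≤j : i′ F.≤ j
    i′≤j = subst (_≤ toℕ j) (sym i′≡1+i) i<j

module _ {n : ℕ} (α : Fin n → Ordinal) where

  SumLt⇒index-≤ : ∀ {p q} → SumLt α p q → proj₁ p F.≤ proj₁ q
  SumLt⇒index-≤ (diff i<j) = ℕ.<⇒≤ i<j
  SumLt⇒index-≤ (same _)   = ℕ.≤-refl

  SumLt-sameBlock : ∀ {i x y} → SumLt α (i , x) (i , y) → Ordinal._<_ (α i) x y
  SumLt-sameBlock (diff i<i) = ⊥-elim (ℕ.<-irrefl refl i<i)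
  SumLt-sameBlock (same x<y) = x<y

  SumLt-wellFounded : WellFounded (SumLt α)
  SumLt-wellFounded =
    Subrelation.wellFounded ⊆lex (Lex.wellFounded <-wellFounded (Ordinal.wellFounded (α _)))
    where
    module Lex = Lexicographic F._<_ (λ i → Ordinal._<_ (α i))
    ⊆lex : ∀ {p q} → SumLt α p q → p Lex.< q
    ⊆lex (diff i<j) = Lex.left i<j
    ⊆lex (same x<y) = Lex.right x<y

module BlockPreservation {n : ℕ} (α : Fin n → Ordinal)
  (shrink : ∀ i j → toℕ j ≡ suc (toℕ i) → Emb (α j) (α i))
  (selfSimilar : ∀ i → suc (toℕ i) < n → ∀ ξ → RemainderIsoToSelf (α i) ξ)
  (f : SumCarrier α → SumCarrier α) (f-emb : IsOrderEmbedding (SumLt α) (SumLt α) f)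
  where

  f-mono : ∀ {p q} → SumLt α p q → SumLt α (f p) (f q)
  f-mono = Equivalence.to (f-emb _ _)

  f-within : ∀ {p q k x y} → f p ≡ (k , x) → f q ≡ (k , y) →
             SumLt α p q → Ordinal._<_ (α k) x y
  f-within fp≡ fq≡ p<q = SumLt-sameBlock α (subst₂ (SumLt α) fp≡ fq≡ (f-mono p<q))

  index-≤-f : ∀ p → proj₁ p F.≤ proj₁ (f p)
  index-≤-f p = ℕ.≮⇒≥ λ fp<p →
    monotone⇒¬φx≺x (SumLt-wellFounded α) f f-mono p (diff fp<p)

  Preserves : Fin n → Set
  Preserves i = ∀ x → proj₁ (f (i , x)) ≡ i

  escape-impossible : ∀ m → (∀ {m′} → m F.< m′ → Preserves m′) →
                      ∀ w₀ → ¬ (m F.< proj₁ (f (m , w₀)))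
  escape-impossible m preserved w₀ m<j =
    monotone⇒¬φx≺x (Ordinal.wellFounded (α m)) ψ ψ-mono c ψc<c
    where
    j = proj₁ (f (m , w₀))
    1+m<n : suc (toℕ m) < n
    1+m<n = ℕ.≤-trans (s≤s m<j) (FP.toℕ<n j)
    m′ = fromℕ< 1+m<n
    m′≡1+m : toℕ m′ ≡ suc (toℕ m)
    m′≡1+m = FP.toℕ-fromℕ< 1+m<n
    m<m′ : m F.< m′
    m<m′ = subst (toℕ m <_) (sym m′≡1+m) ℕ.≤-refl
    m′≤j : m′ F.≤ j
    m′≤j = subst (_≤ toℕ j) (sym m′≡1+m) m<j

    u : Carrier (α m′)
    u = descend (λ k → Carrier (α k)) (λ eq → proj₁ (shrink _ _ eq)) m′≤j (proj₂ (f (m , w₀)))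

    h = proj₁ (selfSimilar m 1+m<n w₀)
    h-mono : ∀ {x y} → Ordinal._<_ (α m) x y → Ordinal._<_ (α m) (h x) (h y)
    h-mono = Equivalence.to (proj₁ (proj₂ (selfSimilar m 1+m<n w₀)) _ _)
    w₀≤h : ∀ x → Ordinal._≤_ (α m) w₀ (h x)
    w₀≤h = proj₁ (proj₂ (proj₂ (selfSimilar m 1+m<n w₀)))

    lands : ∀ v → proj₁ (f (m , h v)) ≡ m′
    lands v = FP.toℕ-injective (ℕ.≤-antisym below-fu above-fw₀)
      where
      below-fu : proj₁ (f (m , h v)) F.≤ m′
      below-fu = subst (λ k → proj₁ (f (m , h v)) F.≤ k) (preserved m<m′ u)
                   (SumLt⇒index-≤ α (f-mono (diff {x = h v} {y = u} m<m′)))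
      above-fw₀ : m′ F.≤ proj₁ (f (m , h v))
      above-fw₀ with w₀≤h v
      ... | inj₁ w₀≡hv = subst (λ x → m′ F.≤ proj₁ (f (m , x))) w₀≡hv m′≤j
      ... | inj₂ w₀<hv = ℕ.≤-trans m′≤j (SumLt⇒index-≤ α (f-mono (same w₀<hv)))

    φ : Carrier (α m) → Carrier (α m′)
    φ v = proj₁ (proj₁≡⇒Σ≡ (f (m , h v)) (lands v))
    f≡φ : ∀ v → f (m , h v) ≡ (m′ , φ v)
    f≡φ v = proj₂ (proj₁≡⇒Σ≡ (f (m , h v)) (lands v))
    top = proj₁≡⇒Σ≡ (f (m′ , u)) (preserved m<m′ u)

    e = proj₁ (shrink m m′ m′≡1+m)
    e-mono : ∀ {x y} → Ordinal._<_ (α m′) x y → Ordinal._<_ (α m) (e x) (e y)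
    e-mono = Equivalence.to (proj₂ (shrink m m′ m′≡1+m) _ _)

    ψ : Carrier (α m) → Carrier (α m)
    ψ v = e (φ v)
    ψ-mono : ∀ {x y} → Ordinal._<_ (α m) x y → Ordinal._<_ (α m) (ψ x) (ψ y)
    ψ-mono x<y = e-mono (f-within (f≡φ _) (f≡φ _) (same (h-mono x<y)))
    c = e (proj₁ top)
    ψc<c : Ordinal._<_ (α m) (ψ c) c
    ψc<c = e-mono (f-within (f≡φ c) (proj₂ top) (diff m<m′))

  preserves : ∀ m → Preserves m
  preserves m = go m (>-wellFounded m)
    where
    go : ∀ m → Acc F._>_ m → Preserves m
    go m (acc rec) w = FP.toℕ-injective (ℕ.≤-antisym
      (ℕ.≮⇒≥ (escape-impossible m (λ m<m′ → go _ (rec m<m′)) w))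
      (index-≤-f (m , w)))

  blockMap : (i : Fin n) → Carrier (α i) → Carrier (α i)
  blockMap i x = proj₁ (proj₁≡⇒Σ≡ (f (i , x)) (preserves i x))

  f≡sumMap : ∀ p → f p ≡ sumMap α blockMap p
  f≡sumMap (i , x) = proj₂ (proj₁≡⇒Σ≡ (f (i , x)) (preserves i x))

  blockMap-emb : ∀ i → IsOrderEmbedding (Ordinal._<_ (α i)) (Ordinal._<_ (α i)) (blockMap i)
  blockMap-emb i x y = mk⇔
    (λ x<y → f-within (f≡sumMap (i , x)) (f≡sumMap (i , y)) (same x<y))
    (λ fx<fy → SumLt-sameBlock α (Equivalence.from (f-emb _ _)
      (subst₂ (SumLt α) (sym (f≡sumMap (i , x))) (sym (f≡sumMap (i , y))) (same fx<fy))))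

lemma6p1 : (n : ℕ) → 1 ≤ n → (α : Fin n → Ordinal) →
    (∀ (i j : Fin n) → toℕ j ≡ suc (toℕ i) → α j ≤ₒ α i) →
    (∀ (i : Fin n) → suc (toℕ i) < n → ∀ (ξ : Carrier (α i)) → RemainderIsoToSelf (α i) ξ) →
    (f : SumCarrier α → SumCarrier α) → IsOrderEmbedding (SumLt α) (SumLt α) f →
    Σ ((i : Fin n) → Carrier (α i) → Carrier (α i)) λ fs →
      (∀ (i : Fin n) → IsOrderEmbedding (Ordinal._<_ (α i)) (Ordinal._<_ (α i)) (fs i))
      × (∀ (p : SumCarrier α) → f p ≡ sumMap α fs p)
lemma6p1 n _ α α-decreasing selfSimilar f f-emb = blockMap , blockMap-emb , f≡sumMap
  where
  open BlockPreservation α (λ i j eq → proj₁ (α-decreasing i j eq)) selfSimilar f f-emb
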